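{- Let $b\ge 2$, and let $N$ be a $b$-ARH number with $k$ digits in base $b$ and additive multiplier $M$. Suppose one of the following holds: (i) $b\ge 10$ and $M\ge b^6$; (ii) $3\le b\le 9$ and $M\ge b^7$; (iii) $b=2$ and $M\ge b^8$. Then $k\le 2\lfloor \log_b M\rfloor$.
   Context: For a positive integer $N$, $s_b(N)$ is the sum of the base-$b$ digits of $N$, and the reversal $N^R$ is the integer obtained by writing the base-$b$ digits of $N$ in reverse order. A positive integer $N$ is a $b$-ARH number if there exists a positive integer $M$ (called an additive multiplier of $N$) such that $N=Ms_b(N)+(Ms_b(N))^R$. $\lfloor x\rfloor$ is the integer part and $\log_b$ the base-$b$ logarithm. -}

module Defs where

open import Data.Nat using (ℕ; zero; suc; _+_; _*_; _^_; _≤_; _<_; NonZero)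
open import Data.Nat.DivMod using (_/_; _%_)
open import Data.List using (List; []; _∷_; reverse; length; foldr)
open import Data.Nat.ListAction using (sum)
open import Data.Product using (_×_)
open import Relation.Binary.PropositionalEquality using (_≡_)

-- Base-b digits of n, least significant first, computed with fuel
-- (fuel n suffices since n / b < n for b ≥ 2, n ≥ 1).
digitsAux : (b : ℕ) → .{{NonZero b}} → ℕ → ℕ → List ℕ
digitsAux b zero    n = []
digitsAux b (suc f) zero = []
digitsAux b (suc f) n@(suc _) = (n % b) ∷ digitsAux b f (n / b)

digits : (b : ℕ) → .{{NonZero b}} → ℕ → List ℕ
digits b n = digitsAux b n n

fromDigits : ℕ → List ℕ → ℕ
fromDigits b = foldr (λ d acc → d + b * acc) 0

s : (b : ℕ) → .{{NonZero b}} → ℕ → ℕ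
s b n = sum (digits b n)

rev : (b : ℕ) → .{{NonZero b}} → ℕ → ℕ
rev b n = fromDigits b (reverse (digits b n))

numDigits : (b : ℕ) → .{{NonZero b}} → ℕ → ℕ
numDigits b n = length (digits b n)

IsAdditiveMultiplier : (b : ℕ) → .{{NonZero b}} → ℕ → ℕ → Set
IsAdditiveMultiplier b N M = 1 ≤ M × N ≡ M * s b N + rev b (M * s b N)

IsFloorLog : ℕ → ℕ → ℕ → Set
IsFloorLog b M L = b ^ L ≤ M × M < b ^ suc L

module Submission where

-- Write P = M·s_b(N), so N = P + P^R, and let k be the number of digits of N
-- and L = ⌊log_b M⌋.
--   * P^R has at most as many digits as P, hence P^R < b^(#digits P) ≤ b·P,
--     so N < (b+1)·P.
--   * every digit is at most b-1, so s_b(N) ≤ (b-1)·k and (b+1)·s_b(N) ≤ b²·k.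
--   * N has k digits, so b^k ≤ b·N; together with M < b^(L+1) this gives
--         b^k < b^(L+4) · k.                                  (growth bound)
--   * under each of the three hypotheses on (b, M) we get L ≥ 6 (b ≥ 3) or
--     L ≥ 8 (b = 2); if k ≥ 2L+1 then j = k - (L+4) satisfies j ≥ 3 (resp. 5)
--     and k ≤ 2j+7 ≤ b^j, i.e. b^(L+4)·k ≤ b^k, contradicting the growth bound.

open import Defs
open import Data.Nat using (ℕ; zero; suc; _+_; _*_; _∸_; _^_; _≤_; _<_; NonZero; z≤n; s≤s; _≤?_)
open import Data.Nat.Properties
open import Data.Nat.DivMod using (_/_; m%n<n; m/n<m; m/n*n≤m)
open import Data.Nat.ListAction using (sum)
open import Data.List using ([]; _∷_; reverse; length)
open import Data.List.Properties using (length-reverse)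
open import Data.List.Relation.Unary.All using (All; []; _∷_)
open import Data.List.Relation.Binary.Permutation.Propositional using (↭-sym)
open import Data.List.Relation.Binary.Permutation.Propositional.Properties using (All-resp-↭; ↭-reverse)
open import Relation.Binary.PropositionalEquality using (_≡_; refl; sym; cong; subst)
open import Data.Product using (_×_; _,_)
open import Data.Sum using (_⊎_; inj₁; inj₂; [_,_])
import Data.Sum as Sum
open import Relation.Nullary.Decidable using (toWitness)
open import Data.Unit using (tt)
open import Data.Nat.Tactic.RingSolver using (solve-∀)

module Digits (b : ℕ) .{{_ : NonZero b}} (2≤b : 2 ≤ b) where

  -- The fuel in `digitsAux` never runs out: n / b < n for b ≥ 2.
  quotient-fuel : ∀ f n → suc n ≤ suc f → suc n / b ≤ f
  quotient-fuel f n le = ≤-pred (≤-trans (m/n<m (suc n) b 2≤b) le)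

  digitsAux-bounded : ∀ f n → All (_< b) (digitsAux b f n)
  digitsAux-bounded zero    n       = []
  digitsAux-bounded (suc f) zero    = []
  digitsAux-bounded (suc f) (suc n) = m%n<n (suc n) b ∷ digitsAux-bounded f (suc n / b)

  digits-bounded : ∀ n → All (_< b) (digits b n)
  digits-bounded n = digitsAux-bounded n n

  -- A number q with ℓ digits satisfies b^(ℓ-1) ≤ q; phrased without subtraction:
  -- b^ℓ ≤ m for every positive m with b·q ≤ m.
  pow-length≤ : ∀ f q m → q ≤ f → b * q ≤ m → 1 ≤ m → b ^ length (digitsAux b f q) ≤ m
  pow-length≤ zero    q       m _  _  1≤m = 1≤m
  pow-length≤ (suc f) zero    m _  _  1≤m = 1≤m
  pow-length≤ (suc f) (suc q) m le bq≤m _ =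
    ≤-trans (*-monoʳ-≤ b (pow-length≤ f (suc q / b) (suc q) (quotient-fuel f q le) b[q/b]≤q (s≤s z≤n))) bq≤m
    where
      b[q/b]≤q : b * (suc q / b) ≤ suc q
      b[q/b]≤q = subst (_≤ suc q) (*-comm (suc q / b) b) (m/n*n≤m (suc q) b)

  pow-numDigits≤ : ∀ n → 1 ≤ n → b ^ numDigits b n ≤ b * n
  pow-numDigits≤ n 1≤n = pow-length≤ n n (b * n) ≤-refl ≤-refl (*-mono-≤ (≤-trans (s≤s z≤n) 2≤b) 1≤n)

  fromDigits< : ∀ ds → All (_< b) ds → fromDigits b ds < b ^ length ds
  fromDigits< []       []         = s≤s z≤n
  fromDigits< (d ∷ ds) (d<b ∷ ds<b) = begin-strict
      d + b * fromDigits b ds   <⟨ +-monoˡ-< (b * fromDigits b ds) d<b ⟩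
      b + b * fromDigits b ds   ≡⟨ sym (*-suc b _) ⟩
      b * suc (fromDigits b ds) ≤⟨ *-monoʳ-≤ b (fromDigits< ds ds<b) ⟩
      b * b ^ length ds         ∎
    where open ≤-Reasoning

  rev< : ∀ n → rev b n < b ^ numDigits b n
  rev< n = subst (λ ℓ → rev b n < b ^ ℓ) (length-reverse (digits b n))
    (fromDigits< (reverse (digits b n))
      (All-resp-↭ (↭-sym (↭-reverse (digits b n))) (digits-bounded n)))

  -- Digits are at most b-1, so a digit sum over ℓ digits satisfies s + ℓ ≤ b·ℓ.
  sum+length≤ : ∀ ds → All (_< b) ds → sum ds + length ds ≤ b * length ds
  sum+length≤ []       []           = z≤n
  sum+length≤ (d ∷ ds) (d<b ∷ ds<b) = begin
      d + sum ds + suc (length ds)   ≡⟨ regroup d (sum ds) (length ds) ⟩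
      suc d + (sum ds + length ds)   ≤⟨ +-mono-≤ d<b (sum+length≤ ds ds<b) ⟩
      b + b * length ds              ≡⟨ sym (*-suc b _) ⟩
      b * suc (length ds)            ∎
    where
      open ≤-Reasoning
      regroup : ∀ x y z → x + y + suc z ≡ suc x + (y + z)
      regroup = solve-∀

  -- Consequence used below: (b+1)·s_b(n) ≤ b²·k, where k is the number of digits of n
  -- (this is (b+1)(b-1)k ≤ b²k).
  digitSum-bound : ∀ n → suc b * s b n ≤ b * b * numDigits b n
  digitSum-bound n = ≤-trans (m≤m+n (suc b * s b n) k) (+-cancelʳ-≤ (b * k) _ _ (begin
      suc b * s b n + k + b * k ≡⟨ factor b (s b n) k ⟩
      suc b * (s b n + k)       ≤⟨ *-monoʳ-≤ (suc b) (sum+length≤ (digits b n) (digits-bounded n)) ⟩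
      suc b * (b * k)           ≡⟨ expand b k ⟩
      b * b * k + b * k         ∎))
    where
      open ≤-Reasoning
      k : ℕ
      k = numDigits b n
      factor : ∀ b s k → suc b * s + k + b * k ≡ suc b * (s + k)
      factor = solve-∀
      expand : ∀ b k → suc b * (b * k) ≡ b * b * k + b * k
      expand = solve-∀

open Digits

-- If N = P + P^R with N ≥ 1 then N < (b+1)·P, since P^R < b^(#digits P) ≤ b·P.
sum-with-reversal< : (b : ℕ) .{{_ : NonZero b}} → 2 ≤ b →
  ∀ N P → N ≡ P + rev b P → 1 ≤ N → N < suc b * P
sum-with-reversal< b 2≤b N zero    refl ()
sum-with-reversal< b 2≤b N P@(suc _) refl _ = begin-strict
    P + rev b P           <⟨ +-monoʳ-< P (rev< b 2≤b P) ⟩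
    P + b ^ numDigits b P ≤⟨ +-monoʳ-≤ P (pow-numDigits≤ b 2≤b P (s≤s z≤n)) ⟩
    P + b * P             ∎
  where open ≤-Reasoning

arh-growth : (b : ℕ) .{{_ : NonZero b}} → 2 ≤ b → ∀ N M L → 1 ≤ N →
  IsAdditiveMultiplier b N M → M < b ^ suc L →
  b ^ numDigits b N < b ^ (4 + L) * numDigits b N
arh-growth b 2≤b N M L 1≤N (_ , N≡P+Pᴿ) M<b^[L+1] = begin-strict
    b ^ k                        ≤⟨ pow-numDigits≤ b 2≤b N 1≤N ⟩
    b * N                        <⟨ *-monoʳ-< b (sum-with-reversal< b 2≤b N (M * s b N) N≡P+Pᴿ 1≤N) ⟩
    b * (suc b * (M * s b N))    ≡⟨ regroup b M (s b N) ⟩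
    b * (M * (suc b * s b N))    ≤⟨ *-monoʳ-≤ b (*-mono-≤ (<⇒≤ M<b^[L+1]) (digitSum-bound b 2≤b N)) ⟩
    b * (b * b ^ L * (b * b * k)) ≡⟨ collect b (b ^ L) k ⟩
    b ^ (4 + L) * k              ∎
  where
    open ≤-Reasoning
    k : ℕ
    k = numDigits b N
    regroup : ∀ b M s → b * (suc b * (M * s)) ≡ b * (M * (suc b * s))
    regroup = solve-∀
    collect : ∀ b x k → b * (b * x * (b * b * k)) ≡ b * (b * (b * (b * x))) * k
    collect = solve-∀

-- Once 2j+7 ≤ b^j holds, it holds for all larger exponents (each step adds 2 on the
-- left and at least doubles the right).
linear≤pow-upward : ∀ b j → 2 ≤ b → 2 * j + 7 ≤ b ^ j → ∀ i → 2 * (i + j) + 7 ≤ b ^ (i + j)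
linear≤pow-upward b j 2≤b base zero    = base
linear≤pow-upward b j 2≤b base (suc i) = begin
    2 * (suc i + j) + 7 ≡⟨ step i j ⟩
    X + 2               ≤⟨ +-monoʳ-≤ X (≤-trans (toWitness {a? = 2 ≤? 7} tt) (m≤n+m 7 (2 * (i + j)))) ⟩
    X + X               ≡⟨ double X ⟩
    2 * X               ≤⟨ *-mono-≤ 2≤b (linear≤pow-upward b j 2≤b base i) ⟩
    b * b ^ (i + j)     ∎
  where
    open ≤-Reasoning
    X : ℕ
    X = 2 * (i + j) + 7
    step : ∀ i j → 2 * (suc i + j) + 7 ≡ (2 * (i + j) + 7) + 2
    step = solve-∀
    double : ∀ x → x + x ≡ 2 * x
    double = solve-∀

linear≤pow : ∀ b j → (3 ≤ b × 3 ≤ j) ⊎ (b ≡ 2 × 5 ≤ j) → 2 * j + 7 ≤ b ^ j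
linear≤pow b j (inj₁ (3≤b , 3≤j)) =
  subst (λ t → 2 * t + 7 ≤ b ^ t) (m∸n+n≡m 3≤j)
    (linear≤pow-upward b 3 (≤-trans (s≤s (s≤s z≤n)) 3≤b)
      (≤-trans (toWitness {a? = 13 ≤? 27} tt) (^-monoˡ-≤ 3 3≤b)) (j ∸ 3))
linear≤pow .2 j (inj₂ (refl , 5≤j)) =
  subst (λ t → 2 * t + 7 ≤ 2 ^ t) (m∸n+n≡m 5≤j)
    (linear≤pow-upward 2 5 (s≤s (s≤s z≤n)) (toWitness {a? = 17 ≤? 32} tt) (j ∸ 5))

-- Exponential versus linear: if L ≥ 6 (b ≥ 3) or L ≥ 8 (b = 2) and k > 2L,
-- then b^(L+4)·k ≤ b^k.  Write k = j + (L+4); then L ≤ j+3, so k ≤ 2j+7 ≤ b^j.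
pow-beats-linear : ∀ b L k → (3 ≤ b × 6 ≤ L) ⊎ (b ≡ 2 × 8 ≤ L) → 2 * L < k →
  b ^ (4 + L) * k ≤ b ^ k
pow-beats-linear b L k large 2L<k = begin
    b ^ (4 + L) * k      ≤⟨ *-monoʳ-≤ (b ^ (4 + L)) (≤-trans k≤2j+7 (linear≤pow b j j-large)) ⟩
    b ^ (4 + L) * b ^ j  ≡⟨ sym (^-distribˡ-+-* b (4 + L) j) ⟩
    b ^ (4 + L + j)      ≡⟨ cong (b ^_) (m+[n∸m]≡n 4+L≤k) ⟩
    b ^ k                ∎
  where
    open ≤-Reasoning
    j : ℕ
    j = k ∸ (4 + L)
    double+1 : ∀ L → L + suc L ≡ suc (2 * L)
    double+1 = solve-∀
    3≤L : 3 ≤ L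
    3≤L = [ (λ (_ , 6≤L) → ≤-trans (toWitness {a? = 3 ≤? 6} tt) 6≤L)
          , (λ (_ , 8≤L) → ≤-trans (toWitness {a? = 3 ≤? 8} tt) 8≤L) ] large
    4+L≤k : 4 + L ≤ k
    4+L≤k = begin
      4 + L       ≡⟨ +-comm 4 L ⟩
      L + 4       ≤⟨ +-monoʳ-≤ L (s≤s 3≤L) ⟩
      L + suc L   ≡⟨ double+1 L ⟩
      suc (2 * L) ≤⟨ 2L<k ⟩
      k           ∎
    k≡j+4+L : k ≡ j + (4 + L)
    k≡j+4+L = sym (m∸n+n≡m 4+L≤k)
    L≤j+3 : L ≤ j + 3
    L≤j+3 = ≤-pred (+-cancelˡ-≤ L _ _ (begin
      L + suc L         ≡⟨ double+1 L ⟩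
      suc (2 * L)       ≤⟨ 2L<k ⟩
      k                 ≡⟨ k≡j+4+L ⟩
      j + (4 + L)       ≡⟨ rearrange j L ⟩
      L + suc (j + 3)   ∎))
      where
        rearrange : ∀ j L → j + (4 + L) ≡ L + suc (j + 3)
        rearrange = solve-∀
    k≤2j+7 : k ≤ 2 * j + 7
    k≤2j+7 = begin
      k                 ≡⟨ k≡j+4+L ⟩
      j + (4 + L)       ≤⟨ +-monoʳ-≤ j (+-monoʳ-≤ 4 L≤j+3) ⟩
      j + (4 + (j + 3)) ≡⟨ simplify j ⟩
      2 * j + 7         ∎
      where
        simplify : ∀ j → j + (4 + (j + 3)) ≡ 2 * j + 7
        simplify = solve-∀
    j-large : (3 ≤ b × 3 ≤ j) ⊎ (b ≡ 2 × 5 ≤ j)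
    j-large = Sum.map (λ (3≤b , 6≤L) → 3≤b , +-cancelʳ-≤ 3 3 j (≤-trans 6≤L L≤j+3))
                      (λ (b≡2 , 8≤L) → b≡2 , +-cancelʳ-≤ 3 5 j (≤-trans 8≤L L≤j+3)) large

exponent≤floorLog : ∀ b .{{_ : NonZero b}} c M L → b ^ c ≤ M → M < b ^ suc L → c ≤ L
exponent≤floorLog b c M L b^c≤M M<b^[L+1] =
  ≮⇒≥ λ L<c → <⇒≱ M<b^[L+1] (≤-trans (^-monoʳ-≤ b L<c) b^c≤M)

hypotheses⇒large-log : ∀ b .{{_ : NonZero b}} M L → M < b ^ suc L →
  (10 ≤ b × b ^ 6 ≤ M) ⊎ ((3 ≤ b × b ≤ 9) × b ^ 7 ≤ M) ⊎ (b ≡ 2 × b ^ 8 ≤ M) →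
  (3 ≤ b × 6 ≤ L) ⊎ (b ≡ 2 × 8 ≤ L)
hypotheses⇒large-log b M L M<b^[L+1] (inj₁ (10≤b , b^6≤M)) =
  inj₁ (≤-trans (toWitness {a? = 3 ≤? 10} tt) 10≤b , exponent≤floorLog b 6 M L b^6≤M M<b^[L+1])
hypotheses⇒large-log b M L M<b^[L+1] (inj₂ (inj₁ ((3≤b , _) , b^7≤M))) =
  inj₁ (3≤b , ≤-trans (n≤1+n 6) (exponent≤floorLog b 7 M L b^7≤M M<b^[L+1]))
hypotheses⇒large-log b M L M<b^[L+1] (inj₂ (inj₂ (b≡2 , b^8≤M))) =
  inj₂ (b≡2 , exponent≤floorLog b 8 M L b^8≤M M<b^[L+1])

theorem37 : (b : ℕ) → .{{_ : NonZero b}} → 2 ≤ b →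
    (N M k L : ℕ) → 1 ≤ N →
    IsAdditiveMultiplier b N M →
    numDigits b N ≡ k →
    ((10 ≤ b × b ^ 6 ≤ M) ⊎ ((3 ≤ b × b ≤ 9) × b ^ 7 ≤ M) ⊎ (b ≡ 2 × b ^ 8 ≤ M)) →
    IsFloorLog b M L →
    k ≤ 2 * L
theorem37 b 2≤b N M k L 1≤N arh refl hyp (_ , M<b^[L+1]) =
  ≮⇒≥ λ 2L<k → <⇒≱ (arh-growth b 2≤b N M L 1≤N arh M<b^[L+1])
                    (pow-beats-linear b L k L-large 2L<k)
  where
    L-large : (3 ≤ b × 6 ≤ L) ⊎ (b ≡ 2 × 8 ≤ L)
    L-large = hypotheses⇒large-log b M L M<b^[L+1] hyp
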